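{- Let $a>1$ be an integer. If $n$ is an overpseudoprime to base $a$ and $n$ is not divisible by $p^2$ for any Wieferich prime $p$ in base $a$, then $n$ is squarefree.
   Context: A prime $p$ is a Wieferich prime in base $a$ if $a^{p-1}\equiv1\pmod{p^2}$. For an integer $m>1$ with $\gcd(m,a)=1$, $h_a(m)$ denotes the multiplicative order of $a$ modulo $m$. The cyclotomic cosets of $a$ modulo $m$ are the orbits of $\{1,2,\ldots,m-1\}$ under $x\mapsto ax\bmod m$; $r_a(m)$ denotes their number. An odd composite number $n$ with $\gcd(n,a)=1$ is called an overpseudoprime to base $a$ if $n=r_a(n)h_a(n)+1$. -}

module Defs where

open import Data.Nat using (ℕ; zero; suc; _+_; _*_; _∸_; _^_; _≤_; _<_; _≤ᵇ_; _%_)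
open import Data.Nat.Divisibility using (_∣_)
open import Data.Nat.Primality using (Prime; Composite)
open import Data.Nat.Coprimality using (Coprime)
open import Data.Nat.Properties using ()
open import Data.List using (List; length; filterᵇ; applyUpTo)
open import Data.Bool using (Bool; true; _∧_)
open import Data.Product using (_×_)
open import Relation.Binary.PropositionalEquality using (_≡_)

-- congruence of natural numbers: Congruent x y m means x ≡ y (mod m)
-- (one of the truncated differences is 0, the other is |x - y|)
Congruent : ℕ → ℕ → ℕ → Set
Congruent x y m = (m ∣ x ∸ y) × (m ∣ y ∸ x)

WieferichPrime : ℕ → ℕ → Set
WieferichPrime a p = Prime p × Congruent (a ^ (p ∸ 1)) 1 (p * p)

IsMultOrder : ℕ → ℕ → ℕ → Set
IsMultOrder a m h =
  (1 ≤ h) × Congruent (a ^ h) 1 m × (∀ k → 1 ≤ k → Congruent (a ^ k) 1 m → h ≤ k)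

allBelow : ℕ → (ℕ → Bool) → Bool
allBelow zero    P = true
allBelow (suc N) P = allBelow N P ∧ P N

-- x is the least element of its cyclotomic coset {a^k x mod m : k ≥ 0},
-- for modulus m = suc k (the first m iterates of x ↦ a x mod m already
-- exhaust the orbit, since the iteration is a function on m residues)
isCosetLeader : (a k x : ℕ) → Bool
isCosetLeader a k x = allBelow (suc k) (λ j → x ≤ᵇ ((a ^ j) * x) % suc k)

-- r_a(m): the number of cyclotomic cosets of a modulo m, i.e. the number of
-- orbits of {1, …, m-1} under x ↦ a x mod m (counted via least representatives)
cosetCount : ℕ → ℕ → ℕ
cosetCount a zero    = 0
cosetCount a (suc k) = length (filterᵇ (isCosetLeader a k) (applyUpTo suc k))

Overpseudoprime : ℕ → ℕ → Set
Overpseudoprime a n =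
  (n % 2 ≡ 1) × Composite n × Coprime n a ×
  (∀ h → IsMultOrder a n h → n ≡ cosetCount a n * h + 1)

SquareFree : ℕ → Set
SquareFree n = ∀ d → d * d ∣ n → d ≡ 1

-- Let p be a prime with p² ∣ n and let h = h_a(n).  Multiplication by a
-- permutes the nonzero residues modulo n, and each orbit is listed by x, ax, …, a^(h-1)x,
-- so n - 1 ≤ r_a(n)·h, with strict inequality as soon as some orbit has fewer than h
-- elements.  For an overpseudoprime n - 1 = r_a(n)·h, hence a^e x ≡ x (mod n) with
-- 0 < x < n forces h ∣ e.  For x = n/p, Fermat's theorem a^(p-1) ≡ 1 (mod p) gives
-- a^(p-1) x ≡ x (mod n), so h ∣ p - 1 and a^(p-1) ≡ 1 (mod n), in particular mod p².
module Submission where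

open import Defs
open import Data.Nat using (ℕ; _<_; _*_)
open import Data.Nat.Divisibility using (_∣_)
open import Relation.Nullary using (¬_)

open import Data.Nat
open import Data.Nat.Properties
open import Data.Nat.Divisibility
open import Data.Nat.DivMod
open import Data.Nat.Coprimality using (Coprime; coprime-divisor)
open import Data.Nat.Primality using (Prime; euclidsLemma; ¬prime[1]; prime⇒irreducible; prime⇒nonTrivial)
open import Data.Nat.Primality.Factorisation using (factorise)
open import Data.Nat.Combinatorics using (_C_; nCn≡1; nCk≡n!/k![n-k]!; k![n∸k]!∣n!)
open import Data.Bool using (T; T?)
open import Data.Bool.Properties using (T-∧)
open import Data.Fin.Base using (Fin; toℕ; fromℕ; fromℕ<) renaming (zero to fzero; suc to fsuc)
open import Data.Fin.Properties using (toℕ-fromℕ; toℕ-fromℕ<; toℕ-inject₁; toℕ<n; pigeonhole)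
open import Data.Vec.Functional using (Vector; tail; init)
open import Data.List using (List; []; _∷_; _++_; length; applyUpTo; upTo; filterᵇ; map; concat; concatMap)
open import Data.Nat.ListAction using (product)
open import Data.Nat.Tactic.RingSolver using (solve-∀)
open import Data.List.Properties using (length-++; length-++-sucʳ; length-applyUpTo; map-++; concat-++)
open import Data.List.Extrema.Nat using (argmin; f[argmin]≤f[xs])
open import Data.List.Membership.Propositional using (_∈_)
open import Data.List.Membership.Propositional.Properties
  using (∈-∃++; ∈-++⁺ˡ; ∈-++⁺ʳ; ∈-applyUpTo⁺; ∈-applyUpTo⁻; ∈-upTo⁺; ∈-filter⁺; ∈-map⁺;
         ∈-concat⁺′)
open import Data.List.Relation.Binary.Subset.Propositional using (_⊆_)
open import Data.List.Relation.Unary.Any using (here; there)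
open import Data.List.Relation.Unary.All as All using (_∷_)
open import Data.List.Relation.Unary.AllPairs using (_∷_)
open import Data.List.Relation.Unary.Unique.Propositional using (Unique; [])
open import Data.List.Relation.Unary.Unique.Propositional.Properties using (applyUpTo⁺₁)
open import Data.Product using (∃-syntax; ∃₂; _×_; _,_; proj₁; proj₂)
open import Data.Sum using (inj₁; inj₂)
open import Function using (_∘_; Equivalence)
open import Level using (0ℓ)
open import Relation.Nullary using (yes; no; contradiction)
open import Relation.Nullary.Decidable using (_×-dec_)
open import Relation.Unary using (Decidable)
open import Relation.Binary using (IsEquivalence; Setoid)
open import Relation.Binary.Definitions using (DecidableEquality)
open import Relation.Binary.PropositionalEquality
import Relation.Binary.Reasoning.Setoid
import Algebra.Properties.CommutativeSemiring.Binomial +-*-commutativeSemiring as Binomial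
open import Algebra.Properties.Semiring.Sum +-*-semiring using (sum; sum-init-last; sum-cong-≗)
import Algebra.Definitions.RawSemiring +-*-rawSemiring as Semiring

private
  variable
    a c d e m p x y : ℕ

module _ {P : ℕ → Set} (P? : Decidable P) where

  least : P m → ∃[ h ] P h × (∀ e → P e → h ≤ e)
  least {m} = search m 0 (λ _ ())
    where
    search : ∀ fuel k → (∀ e → e < k → ¬ P e) → P (k + fuel) →
             ∃[ h ] P h × (∀ e → P e → h ≤ e)
    search fuel k below p with P? k
    ... | yes pk = k , pk , λ e pe → ≮⇒≥ (λ e<k → below e e<k pe)
    search zero k below p | no ¬pk = contradiction (subst P (+-identityʳ k) p) ¬pk
    search (suc fuel) k below p | no ¬pk =
      search fuel (suc k) below′ (subst P (+-suc k fuel) p)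
      where
      below′ : ∀ e → e < suc k → ¬ P e
      below′ e e<1+k with m<1+n⇒m<n∨m≡n e<1+k
      ... | inj₁ e<k  = below e e<k
      ... | inj₂ refl = ¬pk

Congruent-∣ : d ∣ m → Congruent x y m → Congruent x y d
Congruent-∣ d∣m (m∣x∸y , m∣y∸x) = ∣-trans d∣m m∣x∸y , ∣-trans d∣m m∣y∸x

Congruent-*ˡ : ∀ c → Congruent x y m → Congruent (c * x) (c * y) (c * m)
Congruent-*ˡ {x} {y} {m} c (m∣x∸y , m∣y∸x) = scale x y m∣x∸y , scale y x m∣y∸x
  where
  scale : ∀ u v → m ∣ u ∸ v → c * m ∣ c * u ∸ c * v
  scale u v m∣u∸v = subst (c * m ∣_) (*-distribˡ-∸ c u v) (*-monoʳ-∣ c m∣u∸v)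

module Mod (m : ℕ) .{{_ : NonZero m}} where

  -- A record rather than x % m ≡ y % m, so that x and y can be inferred from a proof.
  infix 4 _≈_
  record _≈_ (x y : ℕ) : Set where
    constructor %≡⇒≈
    field ≈⇒%≡ : x % m ≡ y % m
  open _≈_ public

  ≈-isEquivalence : IsEquivalence _≈_
  ≈-isEquivalence = record
    { refl  = %≡⇒≈ refl
    ; sym   = λ x≈y → %≡⇒≈ (sym (≈⇒%≡ x≈y))
    ; trans = λ x≈y y≈z → %≡⇒≈ (trans (≈⇒%≡ x≈y) (≈⇒%≡ y≈z))
    }

  ≈-setoid : Setoid 0ℓ 0ℓ
  ≈-setoid = record { isEquivalence = ≈-isEquivalence }

  open IsEquivalence ≈-isEquivalence public
    using () renaming (refl to ≈-refl; sym to ≈-sym; trans to ≈-trans)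
  module ≈-Reasoning = Relation.Binary.Reasoning.Setoid ≈-setoid

  %-≈ : ∀ x → x % m ≈ x
  %-≈ x = %≡⇒≈ (m%n%n≡m%n x m)

  ∣∸⇒≈ : y ≤ x → m ∣ x ∸ y → x ≈ y
  ∣∸⇒≈ {y} {x} y≤x m∣x∸y = %≡⇒≈ (begin
    x % m             ≡⟨ cong (_% m) (m+[n∸m]≡n y≤x) ⟨
    (y + (x ∸ y)) % m ≡⟨ %-remove-+ʳ y m∣x∸y ⟩
    y % m             ∎)
    where open ≡-Reasoning

  ≈⇒∣∸ : x ≈ y → m ∣ x ∸ y
  ≈⇒∣∸ {x} {y} (%≡⇒≈ x%m≡y%m) = divides (x / m ∸ y / m) (begin
    x ∸ y                                     ≡⟨ cong₂ _∸_ (m≡m%n+[m/n]*n x m) (m≡m%n+[m/n]*n y m) ⟩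
    (x % m + x / m * m) ∸ (y % m + y / m * m) ≡⟨ cong (λ r → (r + x / m * m) ∸ (y % m + y / m * m))
                                                       x%m≡y%m ⟩
    (y % m + x / m * m) ∸ (y % m + y / m * m) ≡⟨ [m+n]∸[m+o]≡n∸o (y % m) _ _ ⟩
    x / m * m ∸ y / m * m                     ≡⟨ *-distribʳ-∸ m (x / m) (y / m) ⟨
    (x / m ∸ y / m) * m                       ∎)
    where open ≡-Reasoning

  Congruent⇒≈ : Congruent x y m → x ≈ y
  Congruent⇒≈ {x} {y} (m∣x∸y , m∣y∸x) with ≤-total y x
  ... | inj₁ y≤x = ∣∸⇒≈ y≤x m∣x∸y
  ... | inj₂ x≤y = ≈-sym (∣∸⇒≈ x≤y m∣y∸x)

  ≈⇒Congruent : x ≈ y → Congruent x y m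
  ≈⇒Congruent x≈y = ≈⇒∣∸ x≈y , ≈⇒∣∸ (≈-sym x≈y)

  +-congˡ : ∀ c → x ≈ y → c + x ≈ c + y
  +-congˡ {x} {y} c (%≡⇒≈ x%m≡y%m) = %≡⇒≈ (begin
    (c + x) % m           ≡⟨ %-distribˡ-+ c x m ⟩
    (c % m + x % m) % m   ≡⟨ cong (λ r → (c % m + r) % m) x%m≡y%m ⟩
    (c % m + y % m) % m   ≡⟨ %-distribˡ-+ c y m ⟨
    (c + y) % m           ∎)
    where open ≡-Reasoning

  *-congˡ : ∀ c → x ≈ y → c * x ≈ c * y
  *-congˡ {x} {y} c (%≡⇒≈ x%m≡y%m) = %≡⇒≈ (begin
    (c * x) % m           ≡⟨ %-distribˡ-* c x m ⟩
    (c % m * (x % m)) % m ≡⟨ cong (λ r → (c % m * r) % m) x%m≡y%m ⟩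
    (c % m * (y % m)) % m ≡⟨ %-distribˡ-* c y m ⟨
    (c * y) % m           ∎)
    where open ≡-Reasoning

  *-congʳ : ∀ c → x ≈ y → x * c ≈ y * c
  *-congʳ {x} {y} c x≈y = subst₂ _≈_ (*-comm c x) (*-comm c y) (*-congˡ c x≈y)

  ^-≈1 : x ≈ 1 → ∀ q → x ^ q ≈ 1
  ^-≈1 x≈1 zero        = ≈-refl
  ^-≈1 {x} x≈1 (suc q) = begin
    x * x ^ q ≈⟨ *-congˡ x (^-≈1 x≈1 q) ⟩
    x * 1     ≡⟨ *-identityʳ x ⟩
    x         ≈⟨ x≈1 ⟩
    1         ∎
    where open ≈-Reasoning

  ^-multiple≈1 : ∀ {h} → x ^ h ≈ 1 → h ∣ e → x ^ e ≈ 1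
  ^-multiple≈1 {x = x} {h = h} x^h≈1 (divides q refl) =
    subst (_≈ 1) (trans (^-*-assoc x h q) (cong (x ^_) (*-comm h q))) (^-≈1 x^h≈1 q)

  ^-%-period : ∀ {h} .{{_ : NonZero h}} → x ^ h ≈ 1 → ∀ e → x ^ e ≈ x ^ (e % h)
  ^-%-period {x = x} {h = h} x^h≈1 e = begin
    x ^ e                         ≡⟨ cong (x ^_) (m≡m%n+[m/n]*n e h) ⟩
    x ^ (e % h + e / h * h)       ≡⟨ ^-distribˡ-+-* x (e % h) (e / h * h) ⟩
    x ^ (e % h) * x ^ (e / h * h) ≈⟨ *-congˡ (x ^ (e % h)) (^-multiple≈1 x^h≈1 (n∣m*n (e / h))) ⟩
    x ^ (e % h) * 1               ≡⟨ *-identityʳ _ ⟩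
    x ^ (e % h)                   ∎
    where open ≈-Reasoning

  *-cancelˡ : Coprime m c → c * x ≈ c * y → x ≈ y
  *-cancelˡ {c} {x} {y} m⊥c cx≈cy =
    Congruent⇒≈ (cancel x y (≈⇒∣∸ cx≈cy) , cancel y x (≈⇒∣∸ (≈-sym cx≈cy)))
    where
    cancel : ∀ u v → m ∣ c * u ∸ c * v → m ∣ u ∸ v
    cancel u v = coprime-divisor m⊥c ∘ subst (m ∣_) (sym (*-distribˡ-∸ c u v))

  ^-*-cancelˡ : Coprime m c → ∀ q → c ^ q * x ≈ c ^ q * y → x ≈ y
  ^-*-cancelˡ {c} {x} {y} m⊥c zero    cx≈cy = subst₂ _≈_ (*-identityˡ x) (*-identityˡ y) cx≈cy
  ^-*-cancelˡ {c} {x} {y} m⊥c (suc q) cx≈cy =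
    ^-*-cancelˡ m⊥c q (*-cancelˡ m⊥c (subst₂ _≈_ (*-assoc c _ x) (*-assoc c _ y) cx≈cy))

×≡* : ∀ m x → m Semiring.× x ≡ m * x
×≡* zero    x = refl
×≡* (suc m) x = cong (x +_) (×≡* m x)

^≡^ : ∀ x m → x Semiring.^ m ≡ x ^ m
^≡^ x zero    = refl
^≡^ x (suc m) = cong (x *_) (^≡^ x m)

binomial : ∀ n x → (1 + x) ^ n ≡ sum (λ (i : Fin (suc n)) → (n C toℕ i) * x ^ (n ∸ toℕ i))
binomial n x = begin
  (1 + x) ^ n                    ≡⟨ ^≡^ (1 + x) n ⟨
  (1 + x) Semiring.^ n           ≡⟨ Binomial.theorem n 1 x ⟩
  Binomial.binomialExpansion 1 x n ≡⟨ sum-cong-≗ {suc n} (term ∘ toℕ) ⟩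
  sum (λ (i : Fin (suc n)) → (n C toℕ i) * x ^ (n ∸ toℕ i)) ∎
  where
  open ≡-Reasoning
  term : ∀ k → (n C k) Semiring.× (1 Semiring.^ k * x Semiring.^ (n ∸ k)) ≡ (n C k) * x ^ (n ∸ k)
  term k = begin
    (n C k) Semiring.× (1 Semiring.^ k * x Semiring.^ (n ∸ k)) ≡⟨ ×≡* (n C k) _ ⟩
    (n C k) * (1 Semiring.^ k * x Semiring.^ (n ∸ k))          ≡⟨ cong₂ (λ u v → (n C k) * (u * v))
                                                                    (trans (^≡^ 1 k) (^-zeroˡ k)) (^≡^ x (n ∸ k)) ⟩
    (n C k) * (1 * x ^ (n ∸ k))                                ≡⟨ cong ((n C k) *_) (*-identityˡ _) ⟩
    (n C k) * x ^ (n ∸ k)                                      ∎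

∣-sum : ∀ {n} (t : Vector ℕ n) → (∀ i → d ∣ t i) → d ∣ sum t
∣-sum {n = zero}  t d∣t = _ ∣0
∣-sum {n = suc n} t d∣t = ∣m∣n⇒∣m+n (d∣t fzero) (∣-sum (tail t) (d∣t ∘ fsuc))

prime∣n!⇒≤ : ∀ {n} → Prime p → p ∣ n ! → p ≤ n
prime∣n!⇒≤ {n = zero} pr p∣1 with refl ← ∣1⇒≡1 p∣1 = contradiction pr ¬prime[1]
prime∣n!⇒≤ {n = suc n} pr p∣n! with euclidsLemma (suc n) (n !) pr p∣n!
... | inj₁ p∣1+n = ∣⇒≤ p∣1+n
... | inj₂ p∣n!  = m≤n⇒m≤1+n (prime∣n!⇒≤ pr p∣n!)

nCk*k!*[n∸k]!≡n! : ∀ {n k} → k ≤ n → (n C k) * (k ! * (n ∸ k) !) ≡ n !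
nCk*k!*[n∸k]!≡n! {n} {k} k≤n =
  trans (cong (_* (k ! * (n ∸ k) !)) (nCk≡n!/k![n-k]! k≤n)) (m/n*n≡m (k![n∸k]!∣n! k≤n))
  where instance _ = k !* (n ∸ k) !≢0

prime∣pCk : ∀ {k} → Prime p → 0 < k → k < p → p ∣ p C k
prime∣pCk {p@(suc p-1)} {k} pr 0<k k<p
  with euclidsLemma (p C k) (k ! * (p ∸ k) !) pr p∣p!
  where
  p∣p! : p ∣ (p C k) * (k ! * (p ∸ k) !)
  p∣p! = subst (p ∣_) (sym (nCk*k!*[n∸k]!≡n! (<⇒≤ k<p))) (m∣m*n (p-1 !))
... | inj₁ p∣pCk = p∣pCk
... | inj₂ p∣k![p∸k]! with euclidsLemma (k !) ((p ∸ k) !) pr p∣k![p∸k]!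
...   | inj₁ p∣k!     = contradiction (prime∣n!⇒≤ pr p∣k!) (<⇒≱ k<p)
...   | inj₂ p∣[p∸k]! =
  contradiction (prime∣n!⇒≤ pr p∣[p∸k]!) (<⇒≱ (∸-monoʳ-< 0<k (<⇒≤ k<p)))

freshman : Prime p → ∀ x → ∃[ M ] p ∣ M × (1 + x) ^ p ≡ M + (1 + x ^ p)
freshman {p@(suc p-1)} pr x = M , ∣-sum (tail (init t)) middle∣ , (begin
  (1 + x) ^ p                   ≡⟨ binomial p x ⟩
  sum t                         ≡⟨ sum-init-last t ⟩
  (t fzero + M) + t (fromℕ p)   ≡⟨ cong₂ (λ u v → (u + M) + v) first last ⟩
  (x ^ p + M) + 1               ≡⟨ rearrange (x ^ p) M ⟩
  M + (1 + x ^ p)               ∎)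
  where
  open ≡-Reasoning
  rearrange : ∀ u v → (u + v) + 1 ≡ v + (1 + u)
  rearrange = solve-∀
  t : Vector ℕ (suc p)
  t i = (p C toℕ i) * x ^ (p ∸ toℕ i)
  first : t fzero ≡ x ^ p
  first = *-identityˡ (x ^ p)
  last : t (fromℕ p) ≡ 1
  last = trans (cong (λ k → (p C k) * x ^ (p ∸ k)) (toℕ-fromℕ p))
                (cong₂ (λ u v → u * x ^ v) (nCn≡1 p) (n∸n≡0 p))
  M = sum (tail (init t))
  middle∣ : ∀ i → p ∣ tail (init t) i
  middle∣ i = ∣m⇒∣m*n _ (prime∣pCk pr z<s (s<s (subst (_< p-1) (sym (toℕ-inject₁ i)) (toℕ<n i))))

fermat-little : Prime p → ∀ x → Congruent (x ^ p) x p
fermat-little {p@(suc _)} pr x = ≈⇒Congruent (x^p≈x x)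
  where
  open Mod p
  x^p≈x : ∀ x → x ^ p ≈ x
  x^p≈x zero    = ≈-refl
  x^p≈x (suc x) with M , p∣M , expand ← freshman pr x = begin
    (1 + x) ^ p       ≡⟨ expand ⟩
    M + (1 + x ^ p)   ≈⟨ %≡⇒≈ (%-remove-+ˡ (1 + x ^ p) p∣M) ⟩
    1 + x ^ p         ≈⟨ +-congˡ 1 (x^p≈x x) ⟩
    1 + x             ∎
    where open ≈-Reasoning

fermat : Prime p → ¬ p ∣ x → Congruent (x ^ (p ∸ 1)) 1 p
fermat {p@(suc p-1)} {x} pr p∤x = ≈⇒Congruent (*-cancelˡ p⊥x (begin
  x * x ^ p-1 ≈⟨ Congruent⇒≈ (fermat-little pr x) ⟩
  x           ≡⟨ *-identityʳ x ⟨
  x * 1       ∎))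
  where
  open Mod p
  open ≈-Reasoning
  p⊥x : Coprime p x
  p⊥x (d∣p , d∣x) with prime⇒irreducible pr d∣p
  ... | inj₁ d≡1  = d≡1
  ... | inj₂ refl = contradiction d∣x p∤x

power-period : ∀ {n} .{{_ : NonZero n}} → Coprime n a → ∃[ d ] 1 ≤ d × Congruent (a ^ d) 1 n
power-period {a = a} {n = n} n⊥a
  with i , j , i<j , residues≡ ←
         pigeonhole (n<1+n n) (λ (i : Fin (suc n)) → fromℕ< (m%n<n (a ^ toℕ i) n))
  = toℕ j ∸ toℕ i , m<n⇒0<n∸m i<j , ≈⇒Congruent a^[j-i]≈1
  where
  open Mod n
  a^i≈a^j : a ^ toℕ i ≈ a ^ toℕ j
  a^i≈a^j = %≡⇒≈ (trans (sym (toℕ-fromℕ< _)) (trans (cong toℕ residues≡) (toℕ-fromℕ< _)))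
  a^[j-i]≈1 : a ^ (toℕ j ∸ toℕ i) ≈ 1
  a^[j-i]≈1 = ^-*-cancelˡ n⊥a (toℕ i) (begin
    a ^ toℕ i * a ^ (toℕ j ∸ toℕ i) ≡⟨ ^-distribˡ-+-* a (toℕ i) _ ⟨
    a ^ (toℕ i + (toℕ j ∸ toℕ i))   ≡⟨ cong (a ^_) (m+[n∸m]≡n (<⇒≤ i<j)) ⟩
    a ^ toℕ j                       ≈⟨ ≈-sym a^i≈a^j ⟩
    a ^ toℕ i                       ≡⟨ *-identityʳ _ ⟨
    a ^ toℕ i * 1                   ∎)
    where open ≈-Reasoning

multOrder-exists : ∀ {n} .{{_ : NonZero n}} → Coprime n a → ∃[ h ] IsMultOrder a n h
multOrder-exists {a = a} {n = n} n⊥a = order (least isPeriod? (proj₂ (power-period n⊥a)))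
  where
  isPeriod? = λ e → (1 ≤? e) ×-dec ((n ∣? a ^ e ∸ 1) ×-dec (n ∣? 1 ∸ a ^ e))
  order : ∃[ h ] (1 ≤ h × Congruent (a ^ h) 1 n) × (∀ e → 1 ≤ e × Congruent (a ^ e) 1 n → h ≤ e) →
          ∃[ h ] IsMultOrder a n h
  order (h , (1≤h , a^h≡1) , minimal) =
    h , 1≤h , a^h≡1 , λ e 1≤e a^e≡1 → minimal e (1≤e , a^e≡1)

module _ {ℓ} {A : Set ℓ} where

  ∈-++-∷⁻ : ∀ {x y : A} xs {ys} → x ∈ xs ++ y ∷ ys → x ≢ y → x ∈ xs ++ ys
  ∈-++-∷⁻ []       (here x≡y) x≢y = contradiction x≡y x≢y
  ∈-++-∷⁻ []       (there x∈ys) _ = x∈ys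
  ∈-++-∷⁻ (z ∷ xs) (here x≡z)   _ = here x≡z
  ∈-++-∷⁻ (z ∷ xs) (there x∈)  x≢y = there (∈-++-∷⁻ xs x∈ x≢y)

  Unique-⊆⇒length≤ : ∀ {xs ys : List A} → Unique xs → xs ⊆ ys → length xs ≤ length ys
  Unique-⊆⇒length≤ [] _ = z≤n
  Unique-⊆⇒length≤ (x≢xs ∷ unique) x∷xs⊆ys
    with ys₁ , ys₂ , refl ← ∈-∃++ (x∷xs⊆ys (here refl)) =
    subst (_ ≤_) (sym (length-++-sucʳ ys₁ _ ys₂))
      (s≤s (Unique-⊆⇒length≤ unique λ z∈xs →
        ∈-++-∷⁻ ys₁ (x∷xs⊆ys (there z∈xs)) (≢-sym (All.lookup x≢xs z∈xs))))

  Unique-⊆-repeat⇒length< : DecidableEquality A → ∀ {xs : List A} ys {y zs} → Unique xs →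
    xs ⊆ ys ++ y ∷ zs → y ∈ ys ++ zs → length xs < length (ys ++ y ∷ zs)
  Unique-⊆-repeat⇒length< _≟_ ys {y} {zs} unique xs⊆ y∈ =
    subst (_ <_) (sym (length-++-sucʳ ys y zs)) (s≤s (Unique-⊆⇒length≤ unique xs⊆ys++zs))
    where
    xs⊆ys++zs : _ ⊆ ys ++ zs
    xs⊆ys++zs {x} x∈xs with x ≟ y
    ... | yes refl = y∈
    ... | no x≢y   = ∈-++-∷⁻ ys (xs⊆ x∈xs) x≢y

allBelow⁺ : ∀ N P → (∀ j → j < N → T (P j)) → T (allBelow N P)
allBelow⁺ zero    P _   = _
allBelow⁺ (suc N) P P<N =
  Equivalence.from T-∧ (allBelow⁺ N P (λ j → P<N j ∘ m<n⇒m<1+n) , P<N N ≤-refl)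

concatMap-++ : ∀ {A B : Set} (f : A → List B) xs ys →
               concatMap f (xs ++ ys) ≡ concatMap f xs ++ concatMap f ys
concatMap-++ f xs ys = trans (cong concat (map-++ f xs ys)) (sym (concat-++ (map f xs) (map f ys)))

length-concatMap : ∀ {A B : Set} {f : A → List B} {c} → (∀ x → length (f x) ≡ c) →
                   ∀ xs → length (concatMap f xs) ≡ length xs * c
length-concatMap         length-f []       = refl
length-concatMap {f = f} length-f (x ∷ xs) =
  trans (length-++ (f x)) (cong₂ _+_ (length-f x) (length-concatMap length-f xs))

module CyclotomicCosets (a k h-1 : ℕ) (n⊥a : Coprime (suc k) a)
                        (a^h≈1 : Mod._≈_ (suc k) (a ^ suc h-1) 1) where

  private
    n = suc k
    h = suc h-1

  open Mod n

  orbit : ℕ → ℕ → ℕ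
  orbit x t = a ^ t * x % n

  orbit-shift : ∀ x i j → orbit (orbit x j) i ≡ orbit x (i + j)
  orbit-shift x i j = ≈⇒%≡ (begin
    a ^ i * (a ^ j * x % n) ≈⟨ *-congˡ (a ^ i) (%-≈ (a ^ j * x)) ⟩
    a ^ i * (a ^ j * x)     ≡⟨ *-assoc (a ^ i) (a ^ j) x ⟨
    a ^ i * a ^ j * x       ≡⟨ cong (_* x) (^-distribˡ-+-* a i j) ⟨
    a ^ (i + j) * x         ∎)
    where open ≈-Reasoning

  orbit-%-period : ∀ x t → orbit x t ≡ orbit x (t % h)
  orbit-%-period x t = ≈⇒%≡ (*-congʳ x (^-%-period a^h≈1 t))

  orbit-start : ∀ {x} → x < n → orbit x 0 ≡ x
  orbit-start {x} x<n = trans (cong (_% n) (*-identityˡ x)) (m<n⇒m%n≡m x<n)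

  orbit-positive : ∀ {x} t → 0 < x → x < n → 0 < orbit x t
  orbit-positive {x} t 0<x x<n = n≢0⇒n>0 λ orbit≡0 → >⇒≢ 0<x (begin
    x         ≡⟨ m<n⇒m%n≡m x<n ⟨
    x % n     ≡⟨ ≈⇒%≡ (^-*-cancelˡ n⊥a t (%≡⇒≈ (trans orbit≡0 (cong (_% n) (sym (*-zeroʳ (a ^ t))))))) ⟩
    0         ∎)
    where open ≡-Reasoning

  orbitList : ℕ → List ℕ
  orbitList x = applyUpTo (orbit x) h

  orbit∈orbitList : ∀ x t → orbit x t ∈ orbitList x
  orbit∈orbitList x t =
    subst (_∈ orbitList x) (sym (orbit-%-period x t)) (∈-applyUpTo⁺ (orbit x) (m%n<n t h))

  leaders : List ℕ
  leaders = filterᵇ (isCosetLeader a k) (applyUpTo suc k)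

  -- The orbit is h-periodic, so the first h exponents already reach its least element.
  leaderExponent : ℕ → ℕ
  leaderExponent x = argmin (orbit x) 0 (upTo h)

  leader : ℕ → ℕ
  leader x = orbit x (leaderExponent x)

  leader-≤ : ∀ x t → leader x ≤ orbit x t
  leader-≤ x t = subst (leader x ≤_) (sym (orbit-%-period x t))
    (All.lookup (f[argmin]≤f[xs] {f = orbit x} 0 (upTo h)) (∈-upTo⁺ (m%n<n t h)))

  leader-isCosetLeader : ∀ x → T (isCosetLeader a k (leader x))
  leader-isCosetLeader x = allBelow⁺ n (λ j → leader x ≤ᵇ orbit (leader x) j) λ j _ → ≤⇒≤ᵇ
    (subst (leader x ≤_) (sym (orbit-shift x j (leaderExponent x))) (leader-≤ x (j + leaderExponent x)))

  ∈-nonzeroResidues : ∀ {x} → 0 < x → x < n → x ∈ applyUpTo suc k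
  ∈-nonzeroResidues {suc x} _ (s<s x<k) = ∈-applyUpTo⁺ suc x<k

  leader∈leaders : ∀ {x} → 0 < x → x < n → leader x ∈ leaders
  leader∈leaders {x} 0<x x<n = ∈-filter⁺ (T? ∘ isCosetLeader a k)
    (∈-nonzeroResidues (orbit-positive (leaderExponent x) 0<x x<n) (m%n<n (a ^ leaderExponent x * x) n))
    (leader-isCosetLeader x)

  ∈-orbitList-leader : ∀ {x} → x < n → x ∈ orbitList (leader x)
  ∈-orbitList-leader {x} x<n =
    subst (_∈ orbitList (leader x)) returns (orbit∈orbitList (leader x) (j * h ∸ j))
    where
    j = leaderExponent x
    returns : orbit (leader x) (j * h ∸ j) ≡ x
    returns = begin
      orbit (leader x) (j * h ∸ j) ≡⟨ orbit-shift x (j * h ∸ j) j ⟩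
      orbit x (j * h ∸ j + j)      ≡⟨ cong (orbit x) (m∸n+n≡m (m≤m*n j h)) ⟩
      orbit x (j * h)              ≡⟨ orbit-%-period x (j * h) ⟩
      orbit x (j * h % h)          ≡⟨ cong (orbit x) (m*n%n≡0 j h) ⟩
      orbit x 0                    ≡⟨ orbit-start x<n ⟩
      x                            ∎
      where open ≡-Reasoning

  nonzeroResidues⊆orbits : applyUpTo suc k ⊆ concatMap orbitList leaders
  nonzeroResidues⊆orbits x∈ with i , i<k , refl ← ∈-applyUpTo⁻ suc x∈ =
    ∈-concat⁺′ (∈-orbitList-leader (s<s i<k)) (∈-map⁺ orbitList (leader∈leaders z<s (s<s i<k)))

  repeating-leader⇒k<count*h : ∀ {L} r → L ∈ leaders → r < h-1 → orbit L (suc r) ≡ orbit L 0 →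
                               k < cosetCount a n * h
  repeating-leader⇒k<count*h {L} r L∈leaders r<h-1 L-cycle = count (∈-∃++ L∈leaders)
    where
    rest = applyUpTo (orbit L ∘ suc) h-1
    count : ∃₂ (λ pre post → leaders ≡ pre ++ L ∷ post) → k < cosetCount a n * h
    count (pre , post , leaders≡) = subst₂ _<_ (length-applyUpTo suc k) length-split
      (Unique-⊆-repeat⇒length< _≟_ before nonzeroResidues-unique (subst (_ ∈_) split ∘ nonzeroResidues⊆orbits)
        (∈-++⁺ʳ before (∈-++⁺ˡ (subst (_∈ rest) L-cycle (∈-applyUpTo⁺ (orbit L ∘ suc) r<h-1)))))
      where
      before = concatMap orbitList pre
      split : concatMap orbitList leaders ≡ before ++ orbit L 0 ∷ (rest ++ concatMap orbitList post)
      split = trans (cong (concatMap orbitList) leaders≡) (concatMap-++ orbitList pre (L ∷ post))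
      length-split : length (before ++ orbit L 0 ∷ (rest ++ concatMap orbitList post)) ≡ cosetCount a n * h
      length-split =
        trans (cong length (sym split)) (length-concatMap (λ y → length-applyUpTo (orbit y) h) leaders)
      nonzeroResidues-unique : Unique (applyUpTo suc k)
      nonzeroResidues-unique = applyUpTo⁺₁ suc k (λ i<j _ → <⇒≢ (s<s i<j))

  repeating-orbit⇒k<count*h : ∀ {x} r → 0 < x → x < n → suc r < h → orbit x (suc r) ≡ x →
                              k < cosetCount a n * h
  repeating-orbit⇒k<count*h {x} r 0<x x<n r<h cycle =
    repeating-leader⇒k<count*h r (leader∈leaders 0<x x<n) (s<s⁻¹ r<h) (begin
      orbit (leader x) (suc r)           ≡⟨ orbit-shift x (suc r) j ⟩
      orbit x (suc r + j)                ≡⟨ cong (orbit x) (+-comm (suc r) j) ⟩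
      orbit x (j + suc r)                ≡⟨ orbit-shift x j (suc r) ⟨
      orbit (orbit x (suc r)) j          ≡⟨ cong (λ y → orbit y j) cycle ⟩
      leader x                           ≡⟨ orbit-start (m%n<n (a ^ j * x) n) ⟨
      orbit (leader x) 0                 ∎)
    where
    open ≡-Reasoning
    j = leaderExponent x

proper-cofactor : ∀ {n} → 1 < p → suc n ≡ m * p → 0 < m × m < suc n
proper-cofactor {p} {m} 1<p n≡m*p =
  0<m , subst (m <_) (sym n≡m*p) (m<m*n m p {{>-nonZero 0<m}} 1<p)
  where
  0<m : 0 < m
  0<m = n≢0⇒n>0 λ m≡0 → 0≢1+n (trans (sym (cong (_* p) m≡0)) (sym n≡m*p))

fermat-cofactor : ∀ {n} .{{_ : NonZero n}} → Prime p → ¬ p ∣ a → n ≡ m * p →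
                  Mod._≈_ n (a ^ (p ∸ 1) * m) m
fermat-cofactor {p} {a} {m} {n} pr p∤a n≡m*p = begin
  a ^ (p ∸ 1) * m ≡⟨ *-comm _ m ⟩
  m * a ^ (p ∸ 1) ≈⟨ Congruent⇒≈ (subst (Congruent (m * a ^ (p ∸ 1)) (m * 1)) (sym n≡m*p)
                                   (Congruent-*ˡ {x = a ^ (p ∸ 1)} {y = 1} m (fermat pr p∤a))) ⟩
  m * 1           ≡⟨ *-identityʳ m ⟩
  m               ∎
  where
  open Mod n
  open ≈-Reasoning

overpseudoprime-fixed⇒order∣ : ∀ {k h} → Overpseudoprime a (suc k) → IsMultOrder a (suc k) h →
                               0 < x → x < suc k → a ^ e * x % suc k ≡ x → h ∣ e
overpseudoprime-fixed⇒order∣ {h = zero} _ (() , _)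
overpseudoprime-fixed⇒order∣ {a = a} {x = x} {e = e} {k = k} {h = suc h-1}
  (_ , _ , n⊥a , n≡r*h+1) order@(_ , a^h≡1 , _) 0<x x<n fixed
  with e % suc h-1 in e%h≡
... | zero  = m%n≡0⇒n∣m e (suc h-1) e%h≡
... | suc r = contradiction (repeating-orbit⇒k<count*h r 0<x x<n r<h cycle) count≯k
  where
  open CyclotomicCosets a k h-1 n⊥a (Mod.Congruent⇒≈ (suc k) a^h≡1)
  cycle : orbit x (suc r) ≡ x
  cycle = trans (cong (orbit x) (sym e%h≡)) (trans (sym (orbit-%-period x e)) fixed)
  r<h : suc r < suc h-1
  r<h = subst (_< suc h-1) e%h≡ (m%n<n e (suc h-1))
  count≯k : ¬ k < cosetCount a (suc k) * suc h-1
  count≯k k<count = n≮n k (subst (k <_) (sym k≡count) k<count)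
    where
    k≡count : k ≡ cosetCount a (suc k) * suc h-1
    k≡count = suc-injective (trans (n≡r*h+1 _ order) (+-comm _ 1))

square-prime-divisor⇒wieferich : ∀ {n} → Overpseudoprime a n → Prime p → p * p ∣ n → WieferichPrime a p
square-prime-divisor⇒wieferich {n = zero} (() , _)
square-prime-divisor⇒wieferich {a = a} {p = p} {n = suc k} op@(_ , _ , n⊥a , _) pr pp∣n =
  pr , Congruent-∣ {x = a ^ (p ∸ 1)} {y = 1} pp∣n (≈⇒Congruent (^-multiple≈1 a^h≈1 h∣p-1))
  where
  open Mod (suc k)
  h = proj₁ (multOrder-exists n⊥a)
  order : IsMultOrder a (suc k) h
  order = proj₂ (multOrder-exists n⊥a)
  a^h≈1 : a ^ h ≈ 1
  a^h≈1 = Congruent⇒≈ (proj₁ (proj₂ order))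
  n/p = quotient pp∣n * p
  n≡n/p*p : suc k ≡ n/p * p
  n≡n/p*p = trans (m∣n⇒n≡quotient*m pp∣n) (sym (*-assoc (quotient pp∣n) p p))
  p∤a : ¬ p ∣ a
  p∤a p∣a = ¬prime[1] (subst Prime (n⊥a (∣-trans (m∣m*n p) pp∣n , p∣a)) pr)
  n/p-bounds : 0 < n/p × n/p < suc k
  n/p-bounds = proper-cofactor (nonTrivial⇒n>1 p {{prime⇒nonTrivial pr}}) n≡n/p*p
  fixed : a ^ (p ∸ 1) * n/p % suc k ≡ n/p
  fixed = trans (≈⇒%≡ (fermat-cofactor pr p∤a n≡n/p*p)) (m<n⇒m%n≡m (proj₂ n/p-bounds))
  h∣p-1 : h ∣ p ∸ 1
  h∣p-1 = overpseudoprime-fixed⇒order∣ op order (proj₁ n/p-bounds) (proj₂ n/p-bounds) fixed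

prime-factor : 1 < d → ∃[ p ] Prime p × p ∣ d
prime-factor {d} 1<d with factorise d {{>-nonZero (<-trans z<s 1<d)}}
... | record { factors = [] ; isFactorisation = d≡1 } = contradiction d≡1 (>⇒≢ 1<d)
... | record { factors = p ∷ ps ; isFactorisation = d≡p*ps ; factorsPrime = pr ∷ _ } =
  p , pr , divides (product ps) (trans d≡p*ps (*-comm p _))

theorem11 : (a n : ℕ) → 1 < a → Overpseudoprime a n →
    (∀ p → WieferichPrime a p → ¬ (p * p ∣ n)) →
    SquareFree n
theorem11 a n _ (odd , _) no-wieferich zero 0∣n with refl ← 0∣⇒≡0 0∣n = contradiction odd λ ()
theorem11 a n _ op no-wieferich (suc zero) _ = refl
theorem11 a n _ op no-wieferich d@(suc (suc _)) dd∣n with p , pr , p∣d ← prime-factor {d} (s<s z<s) =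
  contradiction pp∣n (no-wieferich p (square-prime-divisor⇒wieferich op pr pp∣n))
  where
  pp∣n : p * p ∣ n
  pp∣n = ∣-trans (*-pres-∣ p∣d p∣d) dd∣n
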